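{- Let $r\ge 2$ and $n\ge 0$ be integers. Then $$F^{[r]}_n=\sum_{\alpha_r=0}^{\lfloor\frac{n-r+1}{r}\rfloor}\ \sum_{\alpha_{r-1}=0}^{\lfloor\frac{n-r+1-r\alpha_r}{r-1}\rfloor}\cdots\sum_{\alpha_{r-i}=0}^{\left\lfloor\frac{n-r+1-\sum_{k=0}^{i-1}(r-k)\alpha_{r-k}}{r-i}\right\rfloor}\cdots\sum_{\alpha_2=0}^{\left\lfloor\frac{n-r+1-\sum_{k=3}^{r}k\alpha_k}{2}\right\rfloor}\binom{\alpha_1+\cdots+\alpha_r}{\alpha_1,\dots,\alpha_r}x_1^{\alpha_1}x_2^{\alpha_2}\cdots x_r^{\alpha_r},$$ where in each summand $\alpha_1:=n-r+1-\sum_{k=2}^r k\alpha_k$, and a sum whose upper limit is negative is empty.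
   Context: For an integer $r\ge 1$, the $r$-Fibonacci polynomial $F^{[r]}_n(x_1,\dots,x_r)$ is defined by $F^{[r]}_n=0$ for $0\le n<r-1$, $F^{[r]}_{r-1}=1$, and $F^{[r]}_n=\sum_{i=1}^r x_iF^{[r]}_{n-i}$ for $n\ge r$. $\binom{\alpha_1+\cdots+\alpha_r}{\alpha_1,\dots,\alpha_r}=\frac{(\alpha_1+\cdots+\alpha_r)!}{\alpha_1!\cdots\alpha_r!}$. -}

module Defs where

open import Level using (Level)
open import Algebra.Bundles using (CommutativeRing)
open import Data.Nat using (ℕ; zero; suc; _+_; _*_; _∸_; _<?_; _≟_; _≤?_; NonZero; _!)
open import Data.Nat.Properties using (_!≢0; m*n≢0)
open import Data.Nat.DivMod using (_/_)

open import Data.Fin using (Fin; zero; suc)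
open import Data.List using (List; []; _∷_)
open import Relation.Nullary using (yes; no)

sumℕ : List ℕ → ℕ
sumℕ []       = 0
sumℕ (a ∷ as) = a + sumℕ as

factProd : List ℕ → ℕ
factProd []       = 1
factProd (a ∷ as) = (a !) * factProd as

factProd≢0 : (as : List ℕ) → NonZero (factProd as)
factProd≢0 []       = _
factProd≢0 (a ∷ as) = m*n≢0 (a !) (factProd as) {{a !≢0}} {{factProd≢0 as}}

multinomial : List ℕ → ℕ
multinomial as = _/_ (sumℕ as !) (factProd as) {{factProd≢0 as}}

-- Everything below works over an arbitrary commutative ring R;
-- a polynomial identity in ℤ[x₁,…,x_r] is the same as an identity
-- holding for all elements x₁,…,x_r of all commutative rings.

module _ {c ℓ : Level} (R : CommutativeRing c ℓ) where
  open CommutativeRing R using (Carrier; 0#; 1#) renaming (_+_ to _⊕_; _*_ to _⊗_)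

  fromℕ : ℕ → Carrier
  fromℕ zero    = 0#
  fromℕ (suc n) = 1# ⊕ fromℕ n

  pow : Carrier → ℕ → Carrier
  pow a zero    = 1#
  pow a (suc n) = a ⊗ pow a n

  sumFin : (k : ℕ) → (Fin k → Carrier) → Carrier
  sumFin zero    f = 0#
  sumFin (suc k) f = f zero ⊕ sumFin k (λ i → f (suc i))

  sumTo : ℕ → (ℕ → Carrier) → Carrier
  sumTo zero    f = f 0
  sumTo (suc b) f = sumTo b f ⊕ f (suc b)

  -- x : Fin r → Carrier encodes the variables, x i = x_{i+1}.
  -- r-Fibonacci polynomials, defined with a fuel argument (fuel n+1
  -- suffices to compute F_n, since every recursive call lowers n):
  --   F_n = 0 for n < r-1, F_{r-1} = 1, F_n = Σ_{i=1}^{r} x_i F_{n-i} (n ≥ r).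
  fibFuel : (r : ℕ) → (Fin r → Carrier) → (fuel n : ℕ) → Carrier
  fibFuel r x zero     n = 0#
  fibFuel r x (suc f)  n with n <? r ∸ 1
  ... | yes _ = 0#
  ... | no _ with n ≟ r ∸ 1
  ...   | yes _ = 1#
  ...   | no _  = sumFin r (λ i → x i ⊗ fibFuel r x f (n ∸ suc (Data.Fin.toℕ i)))

  F : (r : ℕ) → (Fin r → Carrier) → ℕ → Carrier
  F r x n = fibFuel r x (suc n) n

  monomial : (k : ℕ) → (Fin k → Carrier) → List ℕ → Carrier
  monomial zero    x as       = 1#
  monomial (suc k) x []       = 1#
  monomial (suc k) x (a ∷ as) = pow (x zero) a ⊗ monomial k (λ i → x (suc i)) as

  summand : (r : ℕ) → (Fin r → Carrier) → List ℕ → Carrier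
  summand r x as = fromℕ (multinomial as) ⊗ monomial r x as

  -- The nested sums: nested r x k m acc, where acc = [α_{k+1},…,α_r]
  -- are the already chosen outer indices and m = n-r+1-Σ_{j>k} j α_j is
  -- the remaining budget:
  --   for k ≥ 2 :  Σ_{α_k = 0}^{⌊m/k⌋} nested (k-1) (m - k α_k) (α_k ∷ acc)
  --   for k = 1 :  the summand with α_1 := m.
  nested : (r : ℕ) → (Fin r → Carrier) → (k m : ℕ) → List ℕ → Carrier
  nested r x zero          m acc = summand r x (m ∷ acc)
  nested r x (suc zero)    m acc = summand r x (m ∷ acc)
  nested r x (suc (suc k)) m acc =
    sumTo (m / suc (suc k))
          (λ a → nested r x (suc k) (m ∸ suc (suc k) * a) (a ∷ acc))

  rhs : (r : ℕ) → (Fin r → Carrier) → ℕ → Carrier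
  rhs r x n with r ≤? suc n
  ... | yes _ = nested r x r (suc n ∸ r) []
  ... | no _  = 0#

-- With Y = Σ_{i<r} x_{i+1} t^{i+1}, the recurrence says that F_{r-1+m} is the coefficient of
-- t^m in (1 − Y)^{-1}. Let V_k(e) be the coefficient sequence of (1 − Y_k)^{-e}, where Y_k
-- only involves x_1,…,x_k. The negative binomial series in the last variable,
--   (1 − Y_{k-1} − x_k t^k)^{-(s+1)} = Σ_a C(a+s, a) x_k^a t^{ka} (1 − Y_{k-1})^{-(a+s+1)},
-- expresses V_k(s+1) through V_{k-1}, and unfolding it from k = r down to k = 1 gives exactly
-- the nested sums, since the products C(α_k + ⋯, α_k) of binomials are multinomial
-- coefficients. Taking this expansion as the definition of V, Pascal's rule yields, by
-- induction on k, the identity (1 − Y_k)^{-(s+1)} (1 − Y_k) = (1 − Y_k)^{-s}; for s = 0 it is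
-- the linear recurrence satisfied by the shifted F, whose solution is unique.
module Submission where

open import Defs
open import Level using (Level)
open import Algebra.Bundles using (CommutativeRing)
open import Data.Nat using (ℕ; zero; suc; _+_; _*_; _∸_; _≤_; _<_; _≤?_; _<?_; _≟_; z≤n; s≤s; s≤s⁻¹; _!)
import Data.Nat.Properties as ℕ
open import Data.Nat.DivMod using (_/_; m/n*n≡m; m*n/n≡m; m/n*n≤m; m/n≤m; /-monoˡ-≤)
open import Data.Nat.Combinatorics using (_C_; nCn≡1; nCk+nC[k+1]≡[n+1]C[k+1]; k![n∸k]!∣n!; nCk≡n!/k![n-k]!)
open import Data.Nat.Induction using (<-rec)
open import Data.Nat.Tactic.RingSolver using (solve-∀)
open import Data.Fin as Fin using (Fin; toℕ)
open import Data.Fin.Properties using (toℕ-inject₁; toℕ-fromℕ; toℕ<n)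
open import Data.Sum using (inj₁; inj₂)
open import Data.List using (List; []; _∷_)
open import Relation.Nullary using (Dec; yes; no)
open import Relation.Nullary.Negation using (contradiction)
open import Relation.Binary.PropositionalEquality as ≡ using (_≡_; cong)

binomial*factorials : ∀ {n k} → k ≤ n → (n C k) * (k ! * (n ∸ k) !) ≡ n !
binomial*factorials {n} {k} k≤n = ≡.trans
  (cong (_* (k ! * (n ∸ k) !)) (nCk≡n!/k![n-k]! k≤n))
  (m/n*n≡m {{ℕ._!*_!≢0 k (n ∸ k)}} (k![n∸k]!∣n! k≤n))

factorial-split : ∀ a L → multinomial L * factProd L ≡ sumℕ L ! →
                  (a + sumℕ L) ! ≡ (((a + sumℕ L) C a) * multinomial L) * factProd (a ∷ L)
factorial-split a L M*Π≡s! = begin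
  (a + s) !                                 ≡⟨ binomial*factorials (ℕ.m≤m+n a s) ⟨
  ((a + s) C a) * (a ! * (a + s ∸ a) !)     ≡⟨ cong (λ t → ((a + s) C a) * (a ! * t !)) (ℕ.m+n∸m≡n a s) ⟩
  ((a + s) C a) * (a ! * s !)               ≡⟨ cong (λ t → ((a + s) C a) * (a ! * t)) M*Π≡s! ⟨
  ((a + s) C a) * (a ! * (M * factProd L))  ≡⟨ rearrange ((a + s) C a) (a !) M (factProd L) ⟩
  (((a + s) C a) * M) * (a ! * factProd L)  ∎
  where
  open ≡.≡-Reasoning
  s M : ℕ
  s = sumℕ L
  M = multinomial L
  rearrange : ∀ c f m p → c * (f * (m * p)) ≡ (c * m) * (f * p)
  rearrange = solve-∀

multinomial*factProd : ∀ L → multinomial L * factProd L ≡ sumℕ L !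
multinomial-∷ : ∀ a L → multinomial (a ∷ L) ≡ ((a + sumℕ L) C a) * multinomial L

multinomial*factProd []      = ≡.refl
multinomial*factProd (a ∷ L) = ≡.trans (cong (_* factProd (a ∷ L)) (multinomial-∷ a L))
                                       (≡.sym (factorial-split a L (multinomial*factProd L)))

multinomial-∷ a L = ≡.trans
  (cong (λ t → (t / factProd (a ∷ L)) {{factProd≢0 (a ∷ L)}}) (factorial-split a L (multinomial*factProd L)))
  (m*n/n≡m _ (factProd (a ∷ L)) {{factProd≢0 (a ∷ L)}})

C-pascal : ∀ b s → (suc b + suc s) C suc b ≡ (b + suc s) C b + (suc b + s) C suc b
C-pascal b s = ≡.trans (≡.sym (nCk+nC[k+1]≡[n+1]C[k+1] (b + suc s) b))
                       (cong (λ t → (b + suc s) C b + t C suc b) (ℕ.+-suc b s))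

[n+0]Cn≡1 : ∀ n → (n + 0) C n ≡ 1
[n+0]Cn≡1 n = ≡.trans (cong (_C n) (ℕ.+-identityʳ n)) (nCn≡1 n)

m∸[1+n]<m : ∀ {m} n → 0 < m → m ∸ suc n < m
m∸[1+n]<m {suc m} n _ = s≤s (ℕ.m∸n≤m m n)

module _ {c ℓ : Level} (R : CommutativeRing c ℓ) where
  open CommutativeRing R hiding (zero) renaming (Carrier to A; _+_ to _⊕_; _*_ to _⊗_)
  open import Algebra.Properties.Semiring.Sum semiring
    using (sum; sum-syntax; sum-cong-≋; ∑-distrib-+; *-distribˡ-sum; sum-init-last; sum-replicate-zero)
  open import Algebra.Properties.Semiring.Mult semiring using (_×_; ×-homo-+; ×1-homo-*)
  open import Algebra.Properties.CommutativeSemigroup +-commutativeSemigroup using (interchange)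
  open import Algebra.Properties.CommutativeSemigroup *-commutativeSemigroup
    using (x∙yz≈y∙xz; xy∙z≈y∙xz; x∙yz≈yx∙z)
  open import Relation.Binary.Reasoning.Setoid setoid

  fromℕ≡×1# : ∀ n → fromℕ R n ≡ n × 1#
  fromℕ≡×1# zero    = ≡.refl
  fromℕ≡×1# (suc n) = cong (1# ⊕_) (fromℕ≡×1# n)

  fromℕ-homo-+ : ∀ a b → fromℕ R (a + b) ≈ fromℕ R a ⊕ fromℕ R b
  fromℕ-homo-+ a b = begin
    fromℕ R (a + b)        ≡⟨ fromℕ≡×1# (a + b) ⟩
    (a + b) × 1#           ≈⟨ ×-homo-+ 1# a b ⟩
    a × 1# ⊕ b × 1#        ≡⟨ ≡.cong₂ _⊕_ (fromℕ≡×1# a) (fromℕ≡×1# b) ⟨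
    fromℕ R a ⊕ fromℕ R b  ∎

  fromℕ-homo-* : ∀ a b → fromℕ R (a * b) ≈ fromℕ R a ⊗ fromℕ R b
  fromℕ-homo-* a b = begin
    fromℕ R (a * b)        ≡⟨ fromℕ≡×1# (a * b) ⟩
    (a * b) × 1#           ≈⟨ ×1-homo-* a b ⟩
    a × 1# ⊗ b × 1#        ≡⟨ ≡.cong₂ _⊗_ (fromℕ≡×1# a) (fromℕ≡×1# b) ⟨
    fromℕ R a ⊗ fromℕ R b  ∎

  fromℕ-1 : fromℕ R 1 ≈ 1#
  fromℕ-1 = +-identityʳ 1#

  pow-1# : ∀ a → pow R 1# a ≈ 1#
  pow-1# zero    = refl
  pow-1# (suc a) = trans (*-identityˡ _) (pow-1# a)

  sumTo-cong : ∀ B {f g : ℕ → A} → (∀ a → a ≤ B → f a ≈ g a) → sumTo R B f ≈ sumTo R B g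
  sumTo-cong zero    f≈g = f≈g 0 z≤n
  sumTo-cong (suc B) f≈g =
    +-cong (sumTo-cong B (λ a a≤B → f≈g a (ℕ.m≤n⇒m≤1+n a≤B))) (f≈g (suc B) ℕ.≤-refl)

  sumTo-zero : ∀ B {f : ℕ → A} → (∀ a → a ≤ B → f a ≈ 0#) → sumTo R B f ≈ 0#
  sumTo-zero zero    f≈0 = f≈0 0 z≤n
  sumTo-zero (suc B) f≈0 =
    trans (+-cong (sumTo-zero B (λ a a≤B → f≈0 a (ℕ.m≤n⇒m≤1+n a≤B))) (f≈0 (suc B) ℕ.≤-refl))
          (+-identityʳ 0#)

  sumTo-extend : ∀ {B B'} (f : ℕ → A) → B ≤ B' → (∀ a → B < a → f a ≈ 0#) → sumTo R B f ≈ sumTo R B' f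
  sumTo-extend {B} {zero}   f z≤n     _    = refl
  sumTo-extend {B} {suc B'} f B≤1+B' tail≈0 with B ≤? B'
  ... | yes B≤B' = trans (sym (+-identityʳ _))
                         (+-cong (sumTo-extend f B≤B' tail≈0) (sym (tail≈0 (suc B') (s≤s B≤B'))))
  ... | no  B≰B' rewrite ℕ.≤-antisym B≤1+B' (ℕ.≰⇒> B≰B') = refl

  sumTo-head : ∀ B (f : ℕ → A) → sumTo R (suc B) f ≈ f 0 ⊕ sumTo R B (λ a → f (suc a))
  sumTo-head zero    f = refl
  sumTo-head (suc B) f = trans (+-congʳ (sumTo-head B f)) (+-assoc _ _ _)

  sumTo-last : ∀ B {f : ℕ → A} → (∀ a → a < B → f a ≈ 0#) → sumTo R B f ≈ f B
  sumTo-last zero    _   = refl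
  sumTo-last (suc B) f≈0 = trans (+-congʳ (sumTo-zero B (λ a a≤B → f≈0 a (s≤s a≤B)))) (+-identityˡ _)

  sumTo-distrib-+ : ∀ B (f g : ℕ → A) → sumTo R B (λ a → f a ⊕ g a) ≈ sumTo R B f ⊕ sumTo R B g
  sumTo-distrib-+ zero    f g = refl
  sumTo-distrib-+ (suc B) f g = trans (+-congʳ (sumTo-distrib-+ B f g)) (interchange _ _ _ _)

  *-distribˡ-sumTo : ∀ B x (f : ℕ → A) → x ⊗ sumTo R B f ≈ sumTo R B (λ a → x ⊗ f a)
  *-distribˡ-sumTo zero    x f = refl
  *-distribˡ-sumTo (suc B) x f = trans (distribˡ x _ _) (+-congʳ (*-distribˡ-sumTo B x f))

  *-distribʳ-sumTo : ∀ B x (f : ℕ → A) → sumTo R B f ⊗ x ≈ sumTo R B (λ a → f a ⊗ x)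
  *-distribʳ-sumTo zero    x f = refl
  *-distribʳ-sumTo (suc B) x f = trans (distribʳ x _ _) (+-congʳ (*-distribʳ-sumTo B x f))

  sumTo-∑-comm : ∀ B k (h : ℕ → Fin k → A) →
                 sumTo R B (λ a → ∑[ i < k ] h a i) ≈ ∑[ i < k ] sumTo R B (λ a → h a i)
  sumTo-∑-comm zero    k h = refl
  sumTo-∑-comm (suc B) k h = begin
    sumTo R B (λ a → ∑[ i < k ] h a i) ⊕ ∑[ i < k ] h (suc B) i
      ≈⟨ +-congʳ (sumTo-∑-comm B k h) ⟩
    ∑[ i < k ] sumTo R B (λ a → h a i) ⊕ ∑[ i < k ] h (suc B) i
      ≈⟨ ∑-distrib-+ (λ i → sumTo R B (λ a → h a i)) (h (suc B)) ⟨
    ∑[ i < k ] (sumTo R B (λ a → h a i) ⊕ h (suc B) i)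
      ∎

  impulse : ℕ → A
  impulse zero    = 1#
  impulse (suc _) = 0#

  -- Sequences ℕ → A are power series in t; delay d g is t^d g.
  delay : ℕ → (ℕ → A) → ℕ → A
  delay d g m with d ≤? m
  ... | yes _ = g (m ∸ d)
  ... | no  _ = 0#

  delay-≤ : ∀ {d m} g → d ≤ m → delay d g m ≡ g (m ∸ d)
  delay-≤ {d} {m} g d≤m with d ≤? m
  ... | yes _   = ≡.refl
  ... | no  d≰m = contradiction d≤m d≰m

  delay-< : ∀ {d m} g → m < d → delay d g m ≡ 0#
  delay-< {d} {m} g m<d with d ≤? m
  ... | yes d≤m = contradiction d≤m (ℕ.<⇒≱ m<d)
  ... | no  _   = ≡.refl

  delay-cong : ∀ d {g h} m → (d ≤ m → g (m ∸ d) ≈ h (m ∸ d)) → delay d g m ≈ delay d h m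
  delay-cong d m eq with d ≤? m
  ... | yes d≤m = eq d≤m
  ... | no  _   = refl

  delay-vanishes : ∀ d {g} m → (d ≤ m → g (m ∸ d) ≈ 0#) → delay d g m ≈ 0#
  delay-vanishes d m eq with d ≤? m
  ... | yes d≤m = eq d≤m
  ... | no  _   = refl

  *-distribˡ-delay : ∀ d x g m → x ⊗ delay d g m ≈ delay d (λ m' → x ⊗ g m') m
  *-distribˡ-delay d x g m with d ≤? m
  ... | yes _ = refl
  ... | no  _ = zeroʳ x

  delay-distrib-+ : ∀ d g h m → delay d (λ m' → g m' ⊕ h m') m ≈ delay d g m ⊕ delay d h m
  delay-distrib-+ d g h m with d ≤? m
  ... | yes _ = refl
  ... | no  _ = sym (+-identityʳ 0#)

  delay-distrib-∑ : ∀ d {k} (h : Fin k → ℕ → A) m →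
                    delay d (λ m' → ∑[ i < k ] h i m') m ≈ ∑[ i < k ] delay d (h i) m
  delay-distrib-∑ d {k} h m with d ≤? m
  ... | yes _ = refl
  ... | no  _ = sym (sum-replicate-zero k)

  delay-delay : ∀ d e g m → delay d (delay e g) m ≈ delay (d + e) g m
  delay-delay d e g m = by-cases (d + e ≤? m)
    where
    by-cases : Dec (d + e ≤ m) → delay d (delay e g) m ≈ delay (d + e) g m
    by-cases (yes d+e≤m) = begin
      delay d (delay e g) m  ≡⟨ delay-≤ _ d≤m ⟩
      delay e g (m ∸ d)      ≡⟨ delay-≤ g (ℕ.m+n≤o⇒m≤o∸n e (≡.subst (_≤ m) (ℕ.+-comm d e) d+e≤m)) ⟩
      g (m ∸ d ∸ e)          ≡⟨ cong g (ℕ.∸-+-assoc m d e) ⟩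
      g (m ∸ (d + e))        ≡⟨ delay-≤ g d+e≤m ⟨
      delay (d + e) g m      ∎
      where
      d≤m : d ≤ m
      d≤m = ℕ.m+n≤o⇒m≤o d d+e≤m
    by-cases (no d+e≰m) = trans
      (delay-vanishes d m (λ d≤m → reflexive (delay-< g (ℕ.≰⇒> (λ e≤m∸d →
         d+e≰m (≡.subst (_≤ m) (ℕ.+-comm e d) (ℕ.m≤o∸n⇒m+n≤o e d≤m e≤m∸d)))))))
      (reflexive (≡.sym (delay-< g (ℕ.≰⇒> d+e≰m))))

  delay-impulse-< : ∀ {d m} → d < m → delay d impulse m ≈ 0#
  delay-impulse-< {d} {suc m} (s≤s d≤m) =
    reflexive (≡.trans (delay-≤ impulse (ℕ.m≤n⇒m≤1+n d≤m)) (cong impulse (ℕ.+-∸-assoc 1 d≤m)))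

  delay-impulse-self : ∀ m → delay m impulse m ≈ 1#
  delay-impulse-self m = reflexive (≡.trans (delay-≤ {m} impulse ℕ.≤-refl) (cong impulse (ℕ.n∸n≡0 m)))

  delay-comm : ∀ d e g m → delay d (delay e g) m ≈ delay e (delay d g) m
  delay-comm d e g m = trans (delay-delay d e g m)
    (trans (reflexive (cong (λ t → delay t g m) (ℕ.+-comm d e))) (sym (delay-delay e d g m)))

  sumTo-div : ∀ k m (f : ℕ → ℕ → A) →
              sumTo R (m / suc k) (λ a → f a (m ∸ suc k * a)) ≈ sumTo R m (λ a → delay (suc k * a) (f a) m)
  sumTo-div k m f = begin
    sumTo R (m / K) (λ a → f a (m ∸ K * a))
      ≈⟨ sumTo-cong (m / K) (λ a a≤m/K → reflexive (≡.sym (delay-≤ (f a) (≤/⇒*≤ a≤m/K)))) ⟩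
    sumTo R (m / K) (λ a → delay (K * a) (f a) m)
      ≈⟨ sumTo-extend _ (m/n≤m m K) (λ a m/K<a →
           reflexive (delay-< (f a) (ℕ.≰⇒> (λ Ka≤m → ℕ.<⇒≱ m/K<a (*≤⇒≤/ Ka≤m))))) ⟩
    sumTo R m (λ a → delay (K * a) (f a) m)
      ∎
    where
    K : ℕ
    K = suc k
    ≤/⇒*≤ : ∀ {a} → a ≤ m / K → K * a ≤ m
    ≤/⇒*≤ a≤m/K = ℕ.≤-trans (ℕ.*-monoʳ-≤ K a≤m/K) (≡.subst (_≤ m) (ℕ.*-comm (m / K) K) (m/n*n≤m m K))
    *≤⇒≤/ : ∀ {a} → K * a ≤ m → a ≤ m / K
    *≤⇒≤/ {a} Ka≤m =
      ≡.subst (_≤ m / K) (m*n/n≡m a K) (/-monoˡ-≤ K (≡.subst (_≤ m) (ℕ.*-comm K a) Ka≤m))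

  -- The a-th series of the family has order at least a, so that seqSum h, which truncates
  -- the sum at a = m, is the genuine power series Σ_a h a.
  Summable : (ℕ → ℕ → A) → Set ℓ
  Summable h = ∀ a m → m < a → h a m ≈ 0#

  seqSum : (ℕ → ℕ → A) → ℕ → A
  seqSum h m = sumTo R m (λ a → h a m)

  seqSum-head : ∀ {h} → Summable h → ∀ m → seqSum h m ≈ h 0 m ⊕ seqSum (λ a → h (suc a)) m
  seqSum-head {h} summable m = trans
    (sumTo-extend (λ a → h a m) (ℕ.n≤1+n m) (λ a m<a → summable a m m<a))
    (sumTo-head m (λ a → h a m))

  seqSum-delay : ∀ d {h} → Summable h → ∀ m → seqSum (λ a → delay d (h a)) m ≈ delay d (seqSum h) m
  seqSum-delay d {h} summable m with d ≤? m
  ... | yes _ = sym (sumTo-extend (λ a → h a (m ∸ d)) (ℕ.m∸n≤m m d) (λ a m∸d<a → summable a (m ∸ d) m∸d<a))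
  ... | no  _ = sumTo-zero m (λ _ _ → refl)

  seqSum-*-delay : ∀ d x {h} → Summable h → ∀ m →
                   seqSum (λ b m' → x ⊗ delay d (h b) m') m ≈ x ⊗ delay d (seqSum h) m
  seqSum-*-delay d x summable m = trans (sym (*-distribˡ-sumTo m x _)) (*-congˡ (seqSum-delay d summable m))

  lagSum : ℕ → (ℕ → A) → (ℕ → A) → ℕ → A
  lagSum k y G m = ∑[ i < k ] (y (toℕ i) ⊗ delay (suc (toℕ i)) G m)

  lagSum-cong : ∀ k y {G H} m → (∀ m' → m' < m → G m' ≈ H m') → lagSum k y G m ≈ lagSum k y H m
  lagSum-cong k y m G≈H = sum-cong-≋ {k} λ i → *-congˡ (delay-cong (suc (toℕ i)) m
    (λ i<m → G≈H (m ∸ suc (toℕ i)) (ℕ.∸-monoʳ-< (s≤s z≤n) i<m)))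

  lagSum-init-last : ∀ k y G m → lagSum (suc k) y G m ≈ lagSum k y G m ⊕ y k ⊗ delay (suc k) G m
  lagSum-init-last k y G m = trans (sum-init-last (λ i → y (toℕ i) ⊗ delay (suc (toℕ i)) G m)) (+-cong
    (sum-cong-≋ {k} λ i → reflexive (cong (λ j → y j ⊗ delay (suc j) G m) (toℕ-inject₁ i)))
    (reflexive (cong (λ j → y j ⊗ delay (suc j) G m) (toℕ-fromℕ k))))

  *-distribˡ-lagSum : ∀ k y x G m → x ⊗ lagSum k y G m ≈ lagSum k y (λ m' → x ⊗ G m') m
  *-distribˡ-lagSum k y x G m = trans (*-distribˡ-sum {k} x _) (sum-cong-≋ {k} λ i →
    trans (x∙yz≈y∙xz x _ _) (*-congˡ (*-distribˡ-delay (suc (toℕ i)) x G m)))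

  delay-lagSum : ∀ d k y G m → delay d (lagSum k y G) m ≈ lagSum k y (delay d G) m
  delay-lagSum d k y G m = trans (delay-distrib-∑ d {k} _ m) (sum-cong-≋ {k} λ i → begin
    delay d (λ m' → y (toℕ i) ⊗ delay (suc (toℕ i)) G m') m
      ≈⟨ *-distribˡ-delay d (y (toℕ i)) _ m ⟨
    y (toℕ i) ⊗ delay d (delay (suc (toℕ i)) G) m
      ≈⟨ *-congˡ (delay-comm d (suc (toℕ i)) G m) ⟩
    y (toℕ i) ⊗ delay (suc (toℕ i)) (delay d G) m
      ∎)

  seqSum-lagSum : ∀ k y {h} → Summable h → ∀ m → seqSum (λ a → lagSum k y (h a)) m ≈ lagSum k y (seqSum h) m
  seqSum-lagSum k y {h} summable m = trans (sumTo-∑-comm m k _) (sum-cong-≋ {k} λ i → begin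
    sumTo R m (λ a → y (toℕ i) ⊗ delay (suc (toℕ i)) (h a) m)
      ≈⟨ *-distribˡ-sumTo m (y (toℕ i)) _ ⟨
    y (toℕ i) ⊗ seqSum (λ a → delay (suc (toℕ i)) (h a)) m
      ≈⟨ *-congˡ (seqSum-delay (suc (toℕ i)) summable m) ⟩
    y (toℕ i) ⊗ delay (suc (toℕ i)) (seqSum h) m
      ∎)

  lagSum-vanishes : ∀ k y {G} m → (∀ m' → m' < m → G m' ≈ 0#) → lagSum k y G m ≈ 0#
  lagSum-vanishes k y m G≈0 = trans (lagSum-cong k y m G≈0) (trans
    (sum-cong-≋ {k} λ i → trans (*-congˡ (delay-vanishes (suc (toℕ i)) m (λ _ → refl))) (zeroʳ _))
    (sum-replicate-zero k))

  lagRecurrence-unique : ∀ k y (f : ℕ → A) {G H : ℕ → A} →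
    (∀ m → G m ≈ f m ⊕ lagSum k y G m) → (∀ m → H m ≈ f m ⊕ lagSum k y H m) →
    ∀ m → G m ≈ H m
  lagRecurrence-unique k y f {G} {H} recG recH = <-rec (λ m → G m ≈ H m) λ m ih →
    trans (recG m) (trans (+-congˡ (lagSum-cong k y m (λ m' m'<m → ih m'<m))) (sym (recH m)))

  module _ (y : ℕ → A) where

    scaledShift : ℕ → ℕ → ℕ → (ℕ → A) → ℕ → A
    scaledShift k n a G m = fromℕ R n ⊗ (pow R (y k) a ⊗ delay (suc k * a) G m)

    -- invPowCoeff k e is (1 − Σ_{i<k} y_i t^{i+1})^{-e}, defined through the negative binomial
    -- series in the last variable y_{k-1}; for e = s + 1 its a-th term is expansionTerm (k-1) s a.
    invPowCoeff : ℕ → ℕ → ℕ → A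
    expansionTerm : ℕ → ℕ → ℕ → ℕ → A

    invPowCoeff k       zero    = impulse
    invPowCoeff zero    (suc s) = impulse
    invPowCoeff (suc k) (suc s) = seqSum (expansionTerm k s)

    expansionTerm k s a = scaledShift k ((a + s) C a) a (invPowCoeff k (suc (a + s)))

    expansionTerm⁻ : ℕ → ℕ → ℕ → ℕ → A
    expansionTerm⁻ k s a = scaledShift k ((a + s) C a) a (invPowCoeff k (a + s))

    scaledShift-summable : ∀ k (n : ℕ → ℕ) (G : ℕ → ℕ → A) → Summable (λ a → scaledShift k (n a) a (G a))
    scaledShift-summable k n G a m m<a = begin
      fromℕ R (n a) ⊗ (pow R (y k) a ⊗ delay (suc k * a) (G a) m)
        ≡⟨ cong (λ t → fromℕ R (n a) ⊗ (pow R (y k) a ⊗ t))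
                (delay-< (G a) (ℕ.<-≤-trans m<a (ℕ.m≤n*m a (suc k)))) ⟩
      fromℕ R (n a) ⊗ (pow R (y k) a ⊗ 0#)
        ≈⟨ trans (*-congˡ (zeroʳ _)) (zeroʳ _) ⟩
      0#
        ∎

    scaledShift-cong : ∀ k n a {G H} m → (∀ m' → G m' ≈ H m') → scaledShift k n a G m ≈ scaledShift k n a H m
    scaledShift-cong k n a m G≈H = *-congˡ (*-congˡ (delay-cong (suc k * a) m (λ _ → G≈H _)))

    scaledShift-distrib-+ : ∀ k n a G H m →
      scaledShift k n a (λ m' → G m' ⊕ H m') m ≈ scaledShift k n a G m ⊕ scaledShift k n a H m
    scaledShift-distrib-+ k n a G H m =
      trans (*-congˡ (trans (*-congˡ (delay-distrib-+ (suc k * a) G H m)) (distribˡ _ _ _))) (distribˡ _ _ _)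

    scaledShift-homo-+ : ∀ k n₁ n₂ a G m →
      scaledShift k (n₁ + n₂) a G m ≈ scaledShift k n₁ a G m ⊕ scaledShift k n₂ a G m
    scaledShift-homo-+ k n₁ n₂ a G m = trans (*-congʳ (fromℕ-homo-+ n₁ n₂)) (distribʳ _ _ _)

    scaledShift-lagSum : ∀ k n a j G m → scaledShift k n a (lagSum j y G) m ≈ lagSum j y (scaledShift k n a G) m
    scaledShift-lagSum k n a j G m = begin
      fromℕ R n ⊗ (pow R (y k) a ⊗ delay (suc k * a) (lagSum j y G) m)
        ≈⟨ *-congˡ (*-congˡ (delay-lagSum (suc k * a) j y G m)) ⟩
      fromℕ R n ⊗ (pow R (y k) a ⊗ lagSum j y (delay (suc k * a) G) m)
        ≈⟨ *-congˡ (*-distribˡ-lagSum j y _ _ m) ⟩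
      fromℕ R n ⊗ lagSum j y (λ m' → pow R (y k) a ⊗ delay (suc k * a) G m') m
        ≈⟨ *-distribˡ-lagSum j y _ _ m ⟩
      lagSum j y (scaledShift k n a G) m
        ∎

    scaledShift-zero : ∀ k G m → scaledShift k 1 0 G m ≈ G m
    scaledShift-zero k G m = begin
      fromℕ R 1 ⊗ (1# ⊗ delay (suc k * 0) G m)  ≈⟨ *-cong fromℕ-1 (*-identityˡ _) ⟩
      1# ⊗ delay (suc k * 0) G m                 ≈⟨ *-identityˡ _ ⟩
      delay (suc k * 0) G m                      ≡⟨ cong (λ d → delay d G m) (ℕ.*-zeroʳ (suc k)) ⟩
      delay 0 G m                                ≡⟨ delay-≤ G z≤n ⟩
      G m                                        ∎

    scaledShift-suc : ∀ k n a G m → scaledShift k n (suc a) G m ≈ y k ⊗ delay (suc k) (scaledShift k n a G) m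
    scaledShift-suc k n a G m = begin
      fromℕ R n ⊗ ((y k ⊗ pow R (y k) a) ⊗ delay (suc k * suc a) G m)
        ≡⟨ cong (λ d → fromℕ R n ⊗ ((y k ⊗ pow R (y k) a) ⊗ delay d G m)) (ℕ.*-suc (suc k) a) ⟩
      fromℕ R n ⊗ ((y k ⊗ pow R (y k) a) ⊗ delay (suc k + suc k * a) G m)
        ≈⟨ *-congˡ (*-congˡ (delay-delay (suc k) (suc k * a) G m)) ⟨
      fromℕ R n ⊗ ((y k ⊗ pow R (y k) a) ⊗ delay (suc k) (delay (suc k * a) G) m)
        ≈⟨ trans (*-congˡ (*-assoc _ _ _)) (x∙yz≈y∙xz _ _ _) ⟩
      y k ⊗ (fromℕ R n ⊗ (pow R (y k) a ⊗ delay (suc k) (delay (suc k * a) G) m))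
        ≈⟨ *-congˡ (trans (*-congˡ (*-distribˡ-delay (suc k) _ _ m)) (*-distribˡ-delay (suc k) _ _ m)) ⟩
      y k ⊗ delay (suc k) (scaledShift k n a G) m
        ∎

    expansionTerm-summable : ∀ k s → Summable (expansionTerm k s)
    expansionTerm-summable k s = scaledShift-summable k (λ b → (b + s) C b) (λ b → invPowCoeff k (suc (b + s)))

    -- Termwise Pascal's rule C(a+s+2, a+1) = C(a+s+1, a) + C(a+s+1, a+1).
    expansionTerm-pascal : ∀ k s m →
      seqSum (expansionTerm⁻ k s) m
      ≈ invPowCoeff (suc k) s m ⊕ y k ⊗ delay (suc k) (invPowCoeff (suc k) (suc s)) m
    expansionTerm-pascal k zero m = begin
      seqSum (expansionTerm⁻ k 0) m
        ≈⟨ seqSum-head (scaledShift-summable k (λ a → (a + 0) C a) _) m ⟩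
      expansionTerm⁻ k 0 0 m ⊕ seqSum (λ b → expansionTerm⁻ k 0 (suc b)) m
        ≈⟨ +-cong (scaledShift-zero k _ m) (sumTo-cong m λ b _ → shifted b) ⟩
      impulse m ⊕ seqSum (λ b m' → y k ⊗ delay (suc k) (expansionTerm k 0 b) m') m
        ≈⟨ +-congˡ (seqSum-*-delay (suc k) (y k) (expansionTerm-summable k 0) m) ⟩
      impulse m ⊕ y k ⊗ delay (suc k) (invPowCoeff (suc k) 1) m
        ∎
      where
      shifted : ∀ b → expansionTerm⁻ k 0 (suc b) m ≈ y k ⊗ delay (suc k) (expansionTerm k 0 b) m
      shifted b = trans
        (reflexive (cong (λ n → scaledShift k n (suc b) (invPowCoeff k (suc b + 0)) m)
                         (≡.trans ([n+0]Cn≡1 (suc b)) (≡.sym ([n+0]Cn≡1 b)))))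
        (scaledShift-suc k ((b + 0) C b) b _ m)
    expansionTerm-pascal k (suc s) m = begin
      seqSum (expansionTerm⁻ k (suc s)) m
        ≈⟨ seqSum-head (scaledShift-summable k (λ a → (a + suc s) C a) _) m ⟩
      expansionTerm⁻ k (suc s) 0 m ⊕ seqSum (λ b → expansionTerm⁻ k (suc s) (suc b)) m
        ≈⟨ +-cong (scaledShift-zero k _ m) (trans (sumTo-cong m λ b _ → split b) (sumTo-distrib-+ m _ _)) ⟩
      invPowCoeff k (suc s) m ⊕ (X ⊕ Y)
        ≈⟨ trans (+-congˡ (+-comm X Y)) (sym (+-assoc _ Y X)) ⟩
      (invPowCoeff k (suc s) m ⊕ Y) ⊕ X
        ≈⟨ +-cong (+-congʳ (sym (scaledShift-zero k _ m)))
                  (seqSum-*-delay (suc k) (y k) (expansionTerm-summable k (suc s)) m) ⟩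
      (expansionTerm k s 0 m ⊕ Y) ⊕ y k ⊗ delay (suc k) (invPowCoeff (suc k) (suc (suc s))) m
        ≈⟨ +-congʳ (seqSum-head (expansionTerm-summable k s) m) ⟨
      invPowCoeff (suc k) (suc s) m ⊕ y k ⊗ delay (suc k) (invPowCoeff (suc k) (suc (suc s))) m
        ∎
      where
      X Y : A
      X = seqSum (λ b m' → y k ⊗ delay (suc k) (expansionTerm k (suc s) b) m') m
      Y = seqSum (λ b → expansionTerm k s (suc b)) m
      split : ∀ b → expansionTerm⁻ k (suc s) (suc b) m
                    ≈ y k ⊗ delay (suc k) (expansionTerm k (suc s) b) m ⊕ expansionTerm k s (suc b) m
      split b = begin
        scaledShift k ((suc b + suc s) C suc b) (suc b) G m
          ≡⟨ cong (λ n → scaledShift k n (suc b) G m) (C-pascal b s) ⟩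
        scaledShift k ((b + suc s) C b + (suc b + s) C suc b) (suc b) G m
          ≈⟨ scaledShift-homo-+ k ((b + suc s) C b) ((suc b + s) C suc b) (suc b) G m ⟩
        scaledShift k ((b + suc s) C b) (suc b) G m ⊕ scaledShift k ((suc b + s) C suc b) (suc b) G m
          ≈⟨ +-cong (scaledShift-suc k ((b + suc s) C b) b G m)
                    (reflexive (cong (λ t → scaledShift k ((suc b + s) C suc b) (suc b) (invPowCoeff k (suc t)) m)
                                     (ℕ.+-suc b s))) ⟩
        y k ⊗ delay (suc k) (expansionTerm k (suc s) b) m ⊕ expansionTerm k s (suc b) m
          ∎
        where
        G : ℕ → A
        G = invPowCoeff k (suc b + suc s)

    invPowCoeff-recurrence : ∀ k s m →
      invPowCoeff k (suc s) m ≈ invPowCoeff k s m ⊕ lagSum k y (invPowCoeff k (suc s)) m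
    invPowCoeff-recurrence zero    zero    m = sym (+-identityʳ _)
    invPowCoeff-recurrence zero    (suc s) m = sym (+-identityʳ _)
    invPowCoeff-recurrence (suc k) s       m = begin
      seqSum (expansionTerm k s) m
        ≈⟨ sumTo-cong m (λ a _ → split a) ⟩
      seqSum (λ a m' → expansionTerm⁻ k s a m' ⊕ lagSum k y (expansionTerm k s a) m') m
        ≈⟨ sumTo-distrib-+ m _ _ ⟩
      seqSum (expansionTerm⁻ k s) m ⊕ seqSum (λ a → lagSum k y (expansionTerm k s a)) m
        ≈⟨ +-cong (expansionTerm-pascal k s m) (seqSum-lagSum k y (expansionTerm-summable k s) m) ⟩
      (invPowCoeff (suc k) s m ⊕ y k ⊗ delay (suc k) G m) ⊕ lagSum k y G m
        ≈⟨ +-assoc _ _ _ ⟩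
      invPowCoeff (suc k) s m ⊕ (y k ⊗ delay (suc k) G m ⊕ lagSum k y G m)
        ≈⟨ +-congˡ (trans (+-comm _ _) (sym (lagSum-init-last k y G m))) ⟩
      invPowCoeff (suc k) s m ⊕ lagSum (suc k) y G m
        ∎
      where
      G : ℕ → A
      G = invPowCoeff (suc k) (suc s)
      split : ∀ a → expansionTerm k s a m ≈ expansionTerm⁻ k s a m ⊕ lagSum k y (expansionTerm k s a) m
      split a = begin
        expansionTerm k s a m
          ≈⟨ scaledShift-cong k n a m (invPowCoeff-recurrence k (a + s)) ⟩
        scaledShift k ((a + s) C a) a (λ m' → invPowCoeff k (a + s) m' ⊕ lagSum k y (invPowCoeff k (suc (a + s))) m') m
          ≈⟨ scaledShift-distrib-+ k n a _ _ m ⟩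
        expansionTerm⁻ k s a m ⊕ scaledShift k ((a + s) C a) a (lagSum k y (invPowCoeff k (suc (a + s)))) m
          ≈⟨ +-congˡ (scaledShift-lagSum k n a k _ m) ⟩
        expansionTerm⁻ k s a m ⊕ lagSum k y (expansionTerm k s a) m
          ∎
        where
        n : ℕ
        n = (a + s) C a

    invPowCoeff-one : ∀ s m → invPowCoeff 1 (suc s) m ≈ fromℕ R ((m + s) C m) ⊗ pow R (y 0) m
    invPowCoeff-one s m = begin
      sumTo R m (λ a → expansionTerm 0 s a m)
        ≈⟨ sumTo-last m vanish ⟩
      fromℕ R ((m + s) C m) ⊗ (pow R (y 0) m ⊗ delay (1 * m) impulse m)
        ≈⟨ *-congˡ (*-congˡ (trans (unit-delay m) (delay-impulse-self m))) ⟩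
      fromℕ R ((m + s) C m) ⊗ (pow R (y 0) m ⊗ 1#)
        ≈⟨ *-congˡ (*-identityʳ _) ⟩
      fromℕ R ((m + s) C m) ⊗ pow R (y 0) m
        ∎
      where
      unit-delay : ∀ a → delay (1 * a) impulse m ≈ delay a impulse m
      unit-delay a = reflexive (cong (λ d → delay d impulse m) (ℕ.*-identityˡ a))
      vanish : ∀ a → a < m → expansionTerm 0 s a m ≈ 0#
      vanish a a<m =
        trans (*-congˡ (trans (*-congˡ (trans (unit-delay a) (delay-impulse-< a<m))) (zeroʳ _))) (zeroʳ _)

    invPowCoeff-floor : ∀ k s m → invPowCoeff (suc k) (suc s) m
      ≈ sumTo R (m / suc k)
          (λ a → fromℕ R ((a + s) C a) ⊗ (pow R (y k) a ⊗ invPowCoeff k (suc (a + s)) (m ∸ suc k * a)))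
    invPowCoeff-floor k s m = sym (trans (sumTo-div k m _) (sumTo-cong m λ a _ →
      sym (trans (*-congˡ (*-distribˡ-delay (suc k * a) _ _ m)) (*-distribˡ-delay (suc k * a) _ _ m))))

  -- Padding with 1# makes the surplus exponents of a long list contribute nothing, as in monomial.
  extend : ∀ {r} → (Fin r → A) → ℕ → A
  extend {zero}  x _       = 1#
  extend {suc r} x zero    = x Fin.zero
  extend {suc r} x (suc i) = extend (λ j → x (Fin.suc j)) i

  extend-toℕ : ∀ {r} (x : Fin r → A) i → extend x (toℕ i) ≡ x i
  extend-toℕ x Fin.zero    = ≡.refl
  extend-toℕ x (Fin.suc i) = extend-toℕ (λ j → x (Fin.suc j)) i

  monomialFrom : (ℕ → A) → ℕ → List ℕ → A
  monomialFrom y o []       = 1#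
  monomialFrom y o (a ∷ as) = pow R (y o) a ⊗ monomialFrom y (suc o) as

  monomialFrom-suc : ∀ y o as → monomialFrom y (suc o) as ≡ monomialFrom (λ i → y (suc i)) o as
  monomialFrom-suc y o []       = ≡.refl
  monomialFrom-suc y o (a ∷ as) = cong (pow R (y (suc o)) a ⊗_) (monomialFrom-suc y (suc o) as)

  monomialFrom-1# : ∀ o as → monomialFrom (λ _ → 1#) o as ≈ 1#
  monomialFrom-1# o []       = refl
  monomialFrom-1# o (a ∷ as) = trans (*-cong (pow-1# a) (monomialFrom-1# (suc o) as)) (*-identityˡ 1#)

  monomial≈monomialFrom : ∀ {r} (x : Fin r → A) as → monomial R r x as ≈ monomialFrom (extend x) 0 as
  monomial≈monomialFrom {zero}  x as       = sym (monomialFrom-1# 0 as)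
  monomial≈monomialFrom {suc r} x []       = refl
  monomial≈monomialFrom {suc r} x (a ∷ as) = *-congˡ (trans
    (monomial≈monomialFrom (λ j → x (Fin.suc j)) as)
    (reflexive (≡.sym (monomialFrom-suc (extend x) 0 as))))

  fromℕ-multinomial-∷ : ∀ a L →
    fromℕ R (multinomial (a ∷ L)) ≈ fromℕ R ((a + sumℕ L) C a) ⊗ fromℕ R (multinomial L)
  fromℕ-multinomial-∷ a L = trans (reflexive (cong (fromℕ R) (multinomial-∷ a L)))
                                  (fromℕ-homo-* ((a + sumℕ L) C a) (multinomial L))

  nested≈invPowCoeff : ∀ {r} (x : Fin r → A) k m acc →
    nested R r x (suc k) m acc
    ≈ fromℕ R (multinomial acc)
      ⊗ (invPowCoeff (extend x) (suc k) (suc (sumℕ acc)) m ⊗ monomialFrom (extend x) (suc k) acc)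
  nested≈invPowCoeff {r} x zero m acc = begin
    fromℕ R (multinomial (m ∷ acc)) ⊗ monomial R r x (m ∷ acc)
      ≈⟨ *-cong (fromℕ-multinomial-∷ m acc) (monomial≈monomialFrom x (m ∷ acc)) ⟩
    (fromℕ R ((m + sumℕ acc) C m) ⊗ M) ⊗ (pow R (y 0) m ⊗ Q)
      ≈⟨ trans (xy∙z≈y∙xz _ M _) (*-congˡ (sym (*-assoc _ _ Q))) ⟩
    M ⊗ ((fromℕ R ((m + sumℕ acc) C m) ⊗ pow R (y 0) m) ⊗ Q)
      ≈⟨ *-congˡ (*-congʳ (invPowCoeff-one y (sumℕ acc) m)) ⟨
    M ⊗ (invPowCoeff y 1 (suc (sumℕ acc)) m ⊗ Q)
      ∎
    where
    y : ℕ → A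
    y = extend x
    M Q : A
    M = fromℕ R (multinomial acc)
    Q = monomialFrom y 1 acc
  nested≈invPowCoeff {r} x (suc k) m acc = begin
    sumTo R (m / K) (λ a → nested R r x (suc k) (m ∸ K * a) (a ∷ acc))
      ≈⟨ sumTo-cong (m / K) (λ a _ → inner a) ⟩
    sumTo R (m / K) (λ a → M ⊗ (g a (m ∸ K * a) ⊗ Q))
      ≈⟨ trans (*-congˡ (*-distribʳ-sumTo (m / K) Q _)) (*-distribˡ-sumTo (m / K) M _) ⟨
    M ⊗ (sumTo R (m / K) (λ a → g a (m ∸ K * a)) ⊗ Q)
      ≈⟨ *-congˡ (*-congʳ (invPowCoeff-floor y (suc k) s m)) ⟨
    M ⊗ (invPowCoeff y (suc (suc k)) (suc s) m ⊗ Q)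
      ∎
    where
    y : ℕ → A
    y = extend x
    K s : ℕ
    K = suc (suc k)
    s = sumℕ acc
    M Q : A
    M = fromℕ R (multinomial acc)
    Q = monomialFrom y K acc
    g : ℕ → ℕ → A
    g a m' = fromℕ R ((a + s) C a) ⊗ (pow R (y (suc k)) a ⊗ invPowCoeff y (suc k) (suc (a + s)) m')
    inner : ∀ a → nested R r x (suc k) (m ∸ K * a) (a ∷ acc) ≈ M ⊗ (g a (m ∸ K * a) ⊗ Q)
    inner a = begin
      nested R r x (suc k) (m ∸ K * a) (a ∷ acc)
        ≈⟨ nested≈invPowCoeff x k (m ∸ K * a) (a ∷ acc) ⟩
      fromℕ R (multinomial (a ∷ acc)) ⊗ (V ⊗ (p ⊗ Q))
        ≈⟨ *-congʳ (fromℕ-multinomial-∷ a acc) ⟩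
      (c′ ⊗ M) ⊗ (V ⊗ (p ⊗ Q))
        ≈⟨ trans (xy∙z≈y∙xz c′ M _)
                 (*-congˡ (trans (*-congˡ (x∙yz≈yx∙z V p Q)) (sym (*-assoc c′ _ Q)))) ⟩
      M ⊗ ((c′ ⊗ (p ⊗ V)) ⊗ Q)
        ∎
      where
      c′ p V : A
      c′ = fromℕ R ((a + s) C a)
      p = pow R (y (suc k)) a
      V = invPowCoeff y (suc k) (suc (a + s)) (m ∸ K * a)

  sumFin-cong : ∀ k {f g : Fin k → A} → (∀ i → f i ≈ g i) → sumFin R k f ≈ sumFin R k g
  sumFin-cong zero    f≈g = refl
  sumFin-cong (suc k) f≈g = +-cong (f≈g Fin.zero) (sumFin-cong k (λ i → f≈g (Fin.suc i)))

  sumFin≡sum : ∀ k (f : Fin k → A) → sumFin R k f ≡ sum f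
  sumFin≡sum zero    f = ≡.refl
  sumFin≡sum (suc k) f = cong (f Fin.zero ⊕_) (sumFin≡sum k (λ i → f (Fin.suc i)))

  module _ (r : ℕ) (x : Fin r → A) where

    fibFuel-fuel-irrelevant : ∀ {f f'} n → n < f → n < f' → fibFuel R r x f n ≈ fibFuel R r x f' n
    fibFuel-fuel-irrelevant {suc f} {suc f'} n (s≤s n≤f) (s≤s n≤f') with n <? r ∸ 1
    ... | yes _ = refl
    ... | no n≮r-1 with n ≟ r ∸ 1
    ...   | yes _    = refl
    ...   | no n≢r-1 = sumFin-cong r λ i → *-congˡ (fibFuel-fuel-irrelevant (n ∸ suc (toℕ i))
              (ℕ.<-≤-trans (m∸[1+n]<m (toℕ i) 0<n) n≤f) (ℕ.<-≤-trans (m∸[1+n]<m (toℕ i) 0<n) n≤f'))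
      where
      0<n : 0 < n
      0<n = ℕ.≤-<-trans z≤n (ℕ.≤∧≢⇒< (ℕ.≮⇒≥ n≮r-1) (≡.≢-sym n≢r-1))

    F-below : ∀ n → n < r ∸ 1 → F R r x n ≈ 0#
    F-below n n<r-1 with n <? r ∸ 1
    ... | yes _     = refl
    ... | no n≮r-1  = contradiction n<r-1 n≮r-1

    F-init : F R r x (r ∸ 1) ≈ 1#
    F-init with (r ∸ 1) <? r ∸ 1
    ... | yes r-1<r-1 = contradiction r-1<r-1 (ℕ.n≮n _)
    ... | no _ with (r ∸ 1) ≟ r ∸ 1
    ...   | yes _     = refl
    ...   | no r-1≢r-1 = contradiction ≡.refl r-1≢r-1

    F-step : ∀ n → r ∸ 1 < n → F R r x n ≈ ∑[ i < r ] (x i ⊗ F R r x (n ∸ suc (toℕ i)))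
    F-step n r-1<n with n <? r ∸ 1
    ... | yes n<r-1 = contradiction n<r-1 (ℕ.<⇒≯ r-1<n)
    ... | no _ with n ≟ r ∸ 1
    ...   | yes n≡r-1 = contradiction (≡.sym n≡r-1) (ℕ.<⇒≢ r-1<n)
    ...   | no _      = trans (sumFin-cong r λ i → *-congˡ (fibFuel-fuel-irrelevant (n ∸ suc (toℕ i))
                          (m∸[1+n]<m (toℕ i) (ℕ.≤-<-trans z≤n r-1<n)) (ℕ.n<1+n _)))
                        (reflexive (sumFin≡sum r _))

  F-lagRecurrence : ∀ k (x : Fin (suc k) → A) n →
    F R (suc k) x n ≈ delay k impulse n ⊕ lagSum (suc k) (extend x) (F R (suc k) x) n
  F-lagRecurrence k x n with n ≤? k
  ... | yes n≤k = begin
      F R (suc k) x n                          ≈⟨ initial n≤k ⟩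
      delay k impulse n                        ≈⟨ +-identityʳ _ ⟨
      delay k impulse n ⊕ 0#                   ≈⟨ +-congˡ (lagSum-vanishes (suc k) (extend x) n
                                                   (λ m m<n → F-below (suc k) x m (ℕ.<-≤-trans m<n n≤k))) ⟨
      delay k impulse n ⊕ lagSum (suc k) (extend x) (F R (suc k) x) n ∎
    where
    initial : ∀ {n} → n ≤ k → F R (suc k) x n ≈ delay k impulse n
    initial n≤k with ℕ.m≤n⇒m<n∨m≡n n≤k
    ... | inj₁ n<k    = trans (F-below (suc k) x _ n<k) (reflexive (≡.sym (delay-< impulse n<k)))
    ... | inj₂ ≡.refl = trans (F-init (suc k) x) (sym (delay-impulse-self k))
  ... | no n≰k = begin
      F R (suc k) x n                                                ≈⟨ F-step (suc k) x n k<n ⟩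
      ∑[ i < suc k ] (x i ⊗ F R (suc k) x (n ∸ suc (toℕ i)))        ≈⟨ sum-cong-≋ {suc k} lag ⟩
      lagSum (suc k) (extend x) (F R (suc k) x) n                    ≈⟨ +-identityˡ _ ⟨
      0# ⊕ lagSum (suc k) (extend x) (F R (suc k) x) n               ≈⟨ +-congʳ (delay-impulse-< k<n) ⟨
      delay k impulse n ⊕ lagSum (suc k) (extend x) (F R (suc k) x) n ∎
    where
    k<n : k < n
    k<n = ℕ.≰⇒> n≰k
    lag : ∀ i → x i ⊗ F R (suc k) x (n ∸ suc (toℕ i))
                ≈ extend x (toℕ i) ⊗ delay (suc (toℕ i)) (F R (suc k) x) n
    lag i = reflexive (≡.cong₂ _⊗_ (≡.sym (extend-toℕ x i))
                                   (≡.sym (delay-≤ (F R (suc k) x) (ℕ.≤-trans (toℕ<n i) k<n))))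

  delayed-invPowCoeff-lagRecurrence : ∀ y k d n →
    delay d (invPowCoeff y k 1) n ≈ delay d impulse n ⊕ lagSum k y (delay d (invPowCoeff y k 1)) n
  delayed-invPowCoeff-lagRecurrence y k d n = begin
    delay d (invPowCoeff y k 1) n
      ≈⟨ delay-cong d n (λ _ → invPowCoeff-recurrence y k 0 _) ⟩
    delay d (λ m → impulse m ⊕ lagSum k y (invPowCoeff y k 1) m) n
      ≈⟨ delay-distrib-+ d _ _ n ⟩
    delay d impulse n ⊕ delay d (lagSum k y (invPowCoeff y k 1)) n
      ≈⟨ +-congˡ (delay-lagSum d k y _ n) ⟩
    delay d impulse n ⊕ lagSum k y (delay d (invPowCoeff y k 1)) n
      ∎

  F≈delayed-invPowCoeff : ∀ k (x : Fin (suc k) → A) n →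
    F R (suc k) x n ≈ delay k (invPowCoeff (extend x) (suc k) 1) n
  F≈delayed-invPowCoeff k x = lagRecurrence-unique (suc k) (extend x) (delay k impulse)
    (F-lagRecurrence k x) (delayed-invPowCoeff-lagRecurrence (extend x) (suc k) k)

  nested-top : ∀ k (x : Fin (suc k) → A) m →
    nested R (suc k) x (suc k) m [] ≈ invPowCoeff (extend x) (suc k) 1 m
  nested-top k x m = trans (nested≈invPowCoeff x k m [])
    (trans (*-cong fromℕ-1 (*-identityʳ _)) (*-identityˡ _))

  F≈rhs : ∀ k (x : Fin (suc k) → A) n → F R (suc k) x n ≈ rhs R (suc k) x n
  F≈rhs k x n with suc k ≤? suc n
  ... | yes k+1≤n+1 = trans (F≈delayed-invPowCoeff k x n)
    (trans (reflexive (delay-≤ _ (s≤s⁻¹ k+1≤n+1))) (sym (nested-top k x (n ∸ k))))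
  ... | no k+1≰n+1 = trans (F≈delayed-invPowCoeff k x n)
    (reflexive (delay-< _ (s≤s⁻¹ (ℕ.≰⇒> k+1≰n+1))))

corollary3p5 : {c ℓ : Level} (R : CommutativeRing c ℓ) (r : ℕ) → 2 ≤ r →
               (x : Fin r → CommutativeRing.Carrier R) (n : ℕ) →
               CommutativeRing._≈_ R (F R r x n) (rhs R r x n)
corollary3p5 R (suc k) _ x n = F≈rhs R k x n
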